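{- For every integer $n\geq2$, $\mu\bigl((UD)^{n-1},(UD)^{n+1}\bigr)=\binom{n}{2}$, where $\mu$ is the M\"obius function of the Dyck pattern poset.
   Context: A Dyck path is a word over $\{U,D\}$ with equally many $U$'s and $D$'s such that every prefix has at least as many $U$'s as $D$'s. The Dyck pattern poset is the set of nonempty Dyck paths ordered by $P\leq Q$ iff $P$ is a subword of $Q$ (obtained by deleting letters, not necessarily consecutive). $(UD)^n$ is $UD$ repeated $n$ times. The M\"obius function is defined by $\mu(x,x)=1$ and $\mu(x,y)=-\sum_{x\leq z<y}\mu(x,z)$ for $x<y$. -}

module Defs where

open import Data.Nat using (ℕ; zero; suc)
open import Data.Bool using (Bool; true; false; T)
open import Data.Integer using (ℤ; -_; +_)
import Data.Integer as ℤ
open import Data.List using (List; []; _∷_; map; _++_; filter; deduplicate; foldr; length; replicate; concat)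
open import Data.Product using (_×_)
open import Relation.Nullary using (Dec; yes; no; ¬_)
open import Relation.Nullary.Decidable using (_×-dec_; ¬?; T?)
open import Relation.Binary.PropositionalEquality using (_≡_)
open import Relation.Binary.Definitions using (DecidableEquality)
open import Data.List.Relation.Binary.Equality.DecPropositional using ()

data Letter : Set where
  U D : Letter

_≟L_ : DecidableEquality Letter
U ≟L U = yes Relation.Binary.PropositionalEquality.refl
U ≟L D = no λ ()
D ≟L U = no λ ()
D ≟L D = yes Relation.Binary.PropositionalEquality.refl

Word : Set
Word = List Letter

open import Data.List.Properties using (≡-dec)

_≟W_ : DecidableEquality Word
_≟W_ = ≡-dec _≟L_

-- Subword (scattered subsequence) order: the stdlib sublist relation
open import Data.List.Relation.Binary.Sublist.DecPropositional _≟L_ public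
  using (_⊆_; _⊆?_)

dyckFrom : ℕ → Word → Bool
dyckFrom zero    []      = true
dyckFrom (suc _) []      = false
dyckFrom h       (U ∷ w) = dyckFrom (suc h) w
dyckFrom zero    (D ∷ w) = false
dyckFrom (suc h) (D ∷ w) = dyckFrom h w

IsDyck : Word → Set
IsDyck w = T (dyckFrom zero w)

NonEmpty : Word → Set
NonEmpty w = ¬ (w ≡ [])

InPoset : Word → Set
InPoset w = IsDyck w × NonEmpty w

inPoset? : (w : Word) → Dec (InPoset w)
inPoset? w = T? (dyckFrom zero w) ×-dec ¬? (w ≟W [])

subwords : Word → List Word
subwords []      = [] ∷ []
subwords (x ∷ w) = map (x ∷_) (subwords w) ++ subwords w

-- the elements z of the poset with x ≤ z < y
-- (every z ≤ y is a subword of y; duplicates removed)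
strictInterval : Word → Word → List Word
strictInterval x y =
  filter (λ z → inPoset? z ×-dec (x ⊆? z) ×-dec ¬? (z ≟W y))
         (deduplicate _≟W_ (subwords y))

sumℤ : List ℤ → ℤ
sumℤ = foldr ℤ._+_ (+ 0)

-- Möbius function, by the recursion μ(x,x)=1, μ(x,y) = -Σ_{x≤z<y} μ(x,z).
-- Fuel: every z < y is strictly shorter than y, so length y + 1 suffices.
mobiusFuel : ℕ → Word → Word → ℤ
mobiusFuel zero    x y = + 0
mobiusFuel (suc k) x y with x ≟W y
... | yes _ = + 1
... | no  _ = - sumℤ (map (mobiusFuel k x) (strictInterval x y))

μ : Word → Word → ℤ
μ x y = mobiusFuel (suc (length y)) x y

UD^ : ℕ → Word
UD^ n = concat (replicate n (U ∷ D ∷ []))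

-- Every element of the interval [(UD)^(n-1), (UD)^(n+1)] is a Dyck path, hence of even length, so
-- apart from its endpoints it consists of Dyck paths of length 2n.  These are exactly the lower covers
-- of (UD)^(n+1), namely (UD)^n and the C(n,2) paths (UD)^a U (UD)^b D (UD)^c with b ≥ 1, and each of
-- them covers (UD)^(n-1).  So the interval has rank 2 with 1 + C(n,2) atoms, and
-- μ = -(1 - (1 + C(n,2))) = C(n,2).

module Submission where

open import Defs
open import Data.Nat using (ℕ; zero; suc; _≤_; _∸_; _+_; s≤s)
import Data.Nat.Properties as ℕ
open import Data.Nat.Combinatorics using (_C_; nC1≡n; nCk+nC[k+1]≡[n+1]C[k+1])
open import Data.Integer using (ℤ; +_; -_)
import Data.Integer as ℤ
import Data.Integer.Properties as ℤ
open import Data.Integer.Tactic.RingSolver using (solve-∀)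
open import Data.Bool using (T)
open import Data.List using (List; []; _∷_; map; _++_; length)
import Data.List.Properties as List
open import Data.List.Membership.Propositional using (_∈_)
open import Data.List.Membership.Propositional.Properties
  using (∈-map⁺; ∈-map⁻; ∈-++⁺ˡ; ∈-++⁺ʳ; ∈-++⁻; ∈-filter⁺; ∈-filter⁻; ∈-deduplicate⁺; ∈-deduplicate⁻)
open import Data.List.Membership.Propositional.Properties.WithK using (unique∧set⇒bag)
open import Data.List.Relation.Unary.Any using (here; there)
open import Data.List.Relation.Unary.All as All using (All; []; _∷_)
import Data.List.Relation.Unary.All.Properties as All
open import Data.List.Relation.Unary.AllPairs using ([]; _∷_)
open import Data.List.Relation.Unary.Unique.Propositional using (Unique)
import Data.List.Relation.Unary.Unique.Propositional.Properties as Unique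
open import Data.List.Relation.Unary.Unique.DecPropositional.Properties _≟W_ using (deduplicate-!)
open import Data.List.Relation.Binary.Sublist.DecPropositional _≟L_ using ([]; _∷_; _∷ʳ_; ⊆-refl; ⊆-trans)
open import Data.List.Relation.Binary.Sublist.Propositional.Properties using (length-mono-≤; to-≋)
open import Data.List.Relation.Binary.Equality.Propositional using (≋⇒≡)
open import Data.List.Relation.Binary.Permutation.Propositional using (_↭_; ↭⇒↭ₛ)
import Data.List.Relation.Binary.Permutation.Propositional.Properties as Perm
open import Data.List.Relation.Binary.Permutation.Setoid.Properties using (foldr-commMonoid)
open import Data.List.Relation.Binary.BagAndSetEquality using (_∼[_]_; set; ∼bag⇒↭)
open import Function.Bundles using (mk⇔)
open import Data.Product using (_×_; _,_; proj₂)
open import Data.Sum using (_⊎_; inj₁; inj₂)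
open import Relation.Nullary using (¬_; yes; no; contradiction)
open import Relation.Nullary.Decidable using (_×-dec_; ¬?)
open import Relation.Binary.PropositionalEquality
  using (_≡_; _≢_; refl; sym; trans; cong; cong₂; subst; setoid; module ≡-Reasoning)

private
  variable
    m : ℕ
    w x y z : Word
    xs ys : Word

data Even : ℕ → Set where
  even-zero : Even zero
  even-2+   : Even m → Even (suc (suc m))

Even-length-UD^ : ∀ j → Even (length (UD^ j))
Even-length-UD^ zero    = even-zero
Even-length-UD^ (suc j) = even-2+ (Even-length-UD^ j)

Even-dyckFrom : ∀ h w → T (dyckFrom h w) → Even (h + length w)
Even-dyckFrom zero    []      _ = even-zero
Even-dyckFrom zero    (U ∷ w) t = Even-dyckFrom 1 w t
Even-dyckFrom (suc h) (U ∷ w) t rewrite ℕ.+-suc h (length w) = Even-dyckFrom (suc (suc h)) w t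
Even-dyckFrom (suc h) (D ∷ w) t rewrite ℕ.+-suc h (length w) = even-2+ (Even-dyckFrom h w t)

even-gap : ∀ {a b} → Even a → Even b → a ≤ b → b ≤ 4 + a → b ≡ a ⊎ b ≡ 2 + a ⊎ b ≡ 4 + a
even-gap even-zero even-zero                             _ _ = inj₁ refl
even-gap even-zero (even-2+ even-zero)                   _ _ = inj₂ (inj₁ refl)
even-gap even-zero (even-2+ (even-2+ even-zero))         _ _ = inj₂ (inj₂ refl)
even-gap even-zero (even-2+ (even-2+ (even-2+ _))) _ (s≤s (s≤s (s≤s (s≤s ()))))
even-gap (even-2+ ea) (even-2+ eb) (s≤s (s≤s a≤b)) (s≤s (s≤s b≤4+a)) with even-gap ea eb a≤b b≤4+a
... | inj₁ e        = inj₁ (cong (λ n → suc (suc n)) e)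
... | inj₂ (inj₁ e) = inj₂ (inj₁ (cong (λ n → suc (suc n)) e))
... | inj₂ (inj₂ e) = inj₂ (inj₂ (cong (λ n → suc (suc n)) e))

even-gap₂ : ∀ {a b} → Even a → Even b → a ≤ b → b ≤ 2 + a → b ≡ a ⊎ b ≡ 2 + a
even-gap₂ even-zero even-zero                     _ _ = inj₁ refl
even-gap₂ even-zero (even-2+ even-zero)           _ _ = inj₂ refl
even-gap₂ even-zero (even-2+ (even-2+ _)) _ (s≤s (s≤s ()))
even-gap₂ (even-2+ ea) (even-2+ eb) (s≤s (s≤s a≤b)) (s≤s (s≤s b≤2+a)) with even-gap₂ ea eb a≤b b≤2+a
... | inj₁ e = inj₁ (cong (λ n → suc (suc n)) e)
... | inj₂ e = inj₂ (cong (λ n → suc (suc n)) e)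

⊆∧length≡⇒≡ : xs ⊆ ys → length xs ≡ length ys → xs ≡ ys
⊆∧length≡⇒≡ p e = ≋⇒≡ (to-≋ e p)

∈-subwords⁺ : z ⊆ y → z ∈ subwords y
∈-subwords⁺ []                 = here refl
∈-subwords⁺ {y = a ∷ y} (_ ∷ʳ p) = ∈-++⁺ʳ (map (a ∷_) (subwords y)) (∈-subwords⁺ p)
∈-subwords⁺ (refl ∷ p)         = ∈-++⁺ˡ (∈-map⁺ _ (∈-subwords⁺ p))

∈-subwords⁻ : ∀ y → z ∈ subwords y → z ⊆ y
∈-subwords⁻ []      (here refl) = []
∈-subwords⁻ (a ∷ y) m with ∈-++⁻ (map (a ∷_) (subwords y)) m
... | inj₂ m′ = a ∷ʳ ∈-subwords⁻ y m′
... | inj₁ m′ with ∈-map⁻ (a ∷_) m′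
...   | _ , m″ , refl = refl ∷ ∈-subwords⁻ y m″

InStrictInterval : Word → Word → Word → Set
InStrictInterval x y z = z ⊆ y × InPoset z × x ⊆ z × z ≢ y

∈-strictInterval⁻ : ∀ x y → z ∈ strictInterval x y → InStrictInterval x y z
∈-strictInterval⁻ x y m with ∈-filter⁻ (λ z → inPoset? z ×-dec (x ⊆? z) ×-dec ¬? (z ≟W y)) m
... | m′ , p = ∈-subwords⁻ y (∈-deduplicate⁻ _≟W_ (subwords y) m′) , p

∈-strictInterval⁺ : ∀ x y → InStrictInterval x y z → z ∈ strictInterval x y
∈-strictInterval⁺ x y (z⊆y , p) =
  ∈-filter⁺ (λ z → inPoset? z ×-dec (x ⊆? z) ×-dec ¬? (z ≟W y))
            (∈-deduplicate⁺ _≟W_ (∈-subwords⁺ z⊆y)) p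

strictInterval-unique : ∀ x y → Unique (strictInterval x y)
strictInterval-unique x y =
  Unique.filter⁺ (λ z → inPoset? z ×-dec (x ⊆? z) ×-dec ¬? (z ≟W y)) (deduplicate-! (subwords y))

sumℤ-↭ : {as bs : List ℤ} → as ↭ bs → sumℤ as ≡ sumℤ bs
sumℤ-↭ p = foldr-commMonoid (setoid ℤ) ℤ.+-0-isCommutativeMonoid (↭⇒↭ₛ p)

sumℤ-const : ∀ (f : Word → ℤ) c zs → All (λ z → f z ≡ c) zs → sumℤ (map f zs) ≡ + length zs ℤ.* c
sumℤ-const f c []       []       = sym (ℤ.*-zeroˡ c)
sumℤ-const f c (z ∷ zs) (p ∷ ps) = begin
  f z ℤ.+ sumℤ (map f zs)     ≡⟨ cong₂ ℤ._+_ p (sumℤ-const f c zs ps) ⟩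
  c ℤ.+ + length zs ℤ.* c     ≡⟨ sym (ℤ.suc-* (+ length zs) c) ⟩
  + suc (length zs) ℤ.* c     ∎
  where open ≡-Reasoning

sumℤ-strictInterval : ∀ (f : Word → ℤ) x y {zs} → Unique zs → strictInterval x y ∼[ set ] zs →
                      sumℤ (map f (strictInterval x y)) ≡ sumℤ (map f zs)
sumℤ-strictInterval f x y u eq =
  sumℤ-↭ (Perm.map⁺ f (∼bag⇒↭ (unique∧set⇒bag (strictInterval-unique x y) u eq)))

mobiusFuel-refl : ∀ k x → mobiusFuel (suc k) x x ≡ + 1
mobiusFuel-refl k x with x ≟W x
... | yes _  = refl
... | no x≢x = contradiction refl x≢x

mobiusFuel-≢ : ∀ k → x ≢ y → mobiusFuel (suc k) x y ≡ - sumℤ (map (mobiusFuel k x) (strictInterval x y))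
mobiusFuel-≢ {x} {y} k x≢y with x ≟W y
... | yes x≡y = contradiction x≡y x≢y
... | no _    = refl

mobiusFuel-cover : ∀ k → x ≢ z → strictInterval x z ∼[ set ] x ∷ [] → mobiusFuel (suc (suc k)) x z ≡ - + 1
mobiusFuel-cover {x} {z} k x≢z eq = begin
  mobiusFuel (suc (suc k)) x z                                 ≡⟨ mobiusFuel-≢ (suc k) x≢z ⟩
  - sumℤ (map (mobiusFuel (suc k) x) (strictInterval x z))   ≡⟨ cong -_ (sumℤ-strictInterval _ x z ([] ∷ []) eq) ⟩
  - (mobiusFuel (suc k) x x ℤ.+ + 0)                           ≡⟨ cong (λ a → - (a ℤ.+ + 0)) (mobiusFuel-refl k x) ⟩
  - + 1                                                         ∎
  where open ≡-Reasoning

-[1+n*-1]≡n-1 : ∀ n → - (+ 1 ℤ.+ n ℤ.* - + 1) ≡ n ℤ.- + 1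
-[1+n*-1]≡n-1 = solve-∀

mobiusFuel-rank2 : ∀ k {atoms} → x ≢ y → Unique (x ∷ atoms) → strictInterval x y ∼[ set ] x ∷ atoms →
                   (∀ {z} → z ∈ atoms → strictInterval x z ∼[ set ] x ∷ []) →
                   mobiusFuel (suc (suc (suc k))) x y ≡ + length atoms ℤ.- + 1
mobiusFuel-rank2 {x} {y} k {atoms} x≢y u@(x∉atoms ∷ _) eq covers = begin
  mobiusFuel (suc (suc (suc k))) x y                       ≡⟨ mobiusFuel-≢ (suc (suc k)) x≢y ⟩
  - sumℤ (map f (strictInterval x y))                      ≡⟨ cong -_ (sumℤ-strictInterval f x y u eq) ⟩
  - (f x ℤ.+ sumℤ (map f atoms))                           ≡⟨ cong₂ (λ a b → - (a ℤ.+ b)) (mobiusFuel-refl (suc k) x) sum-atoms ⟩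
  - (+ 1 ℤ.+ + length atoms ℤ.* - + 1)                     ≡⟨ -[1+n*-1]≡n-1 (+ length atoms) ⟩
  + length atoms ℤ.- + 1                                   ∎
  where
  open ≡-Reasoning
  f : Word → ℤ
  f = mobiusFuel (suc (suc k)) x
  sum-atoms : sumℤ (map f atoms) ≡ + length atoms ℤ.* - + 1
  sum-atoms = sumℤ-const f (- + 1) atoms
    (All.tabulate (λ z∈atoms → mobiusFuel-cover k (All.lookup x∉atoms z∈atoms) (covers z∈atoms)))

UD^-⊆-UD^-suc : ∀ j → UD^ j ⊆ UD^ (suc j)
UD^-⊆-UD^-suc zero    = U ∷ʳ D ∷ʳ []
UD^-⊆-UD^-suc (suc j) = refl ∷ refl ∷ UD^-⊆-UD^-suc j

UD^-isDyck : ∀ j → IsDyck (UD^ j)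
UD^-isDyck zero    = _
UD^-isDyck (suc j) = UD^-isDyck j

UD^-¬dyckFrom-suc : ∀ h j → ¬ T (dyckFrom (suc h) (UD^ j))
UD^-¬dyckFrom-suc h zero    ()
UD^-¬dyckFrom-suc h (suc j) = UD^-¬dyckFrom-suc h j

DyckSubwordFrom : ℕ → ℕ → Word → Set
DyckSubwordFrom h j w = T (dyckFrom h w) × w ⊆ UD^ (suc j) × length w ≡ h + length (UD^ j)

-- raised j lists the words (UD)^i D (UD)^(j-i) with 1 ≤ i ≤ j; together with D (UD)^j (the case
-- i = 0) these are the words obtained from (UD)^(j+1) by deleting one U.
raised : ℕ → List Word
raised zero    = []
raised (suc j) = map (λ w → U ∷ D ∷ w) ((D ∷ UD^ j) ∷ raised j)

-- The lower covers of (UD)^(j+1), i.e. its Dyck subwords of length 2j: besides (UD)^j these are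
-- (UD)^a U (UD)^b D (UD)^c with b ≥ 1 and a + b + c = j - 1.
lowerCovers : ℕ → List Word
lowerCovers zero    = [] ∷ []
lowerCovers (suc j) = map (λ w → U ∷ D ∷ w) (lowerCovers j) ++ map (U ∷_) (raised j)

UD^-∈-lowerCovers : ∀ j → UD^ j ∈ lowerCovers j
UD^-∈-lowerCovers zero    = here refl
UD^-∈-lowerCovers (suc j) = ∈-++⁺ˡ (∈-map⁺ _ (UD^-∈-lowerCovers j))

raised-sound : ∀ j → All (λ w → DyckSubwordFrom 1 j w × UD^ j ⊆ w) ((D ∷ UD^ j) ∷ raised j)
raised-sound zero    = ((_ , U ∷ʳ refl ∷ [] , refl) , D ∷ʳ []) ∷ []
raised-sound (suc j) =
  ((UD^-isDyck (suc j) , U ∷ʳ ⊆-refl , refl) , D ∷ʳ ⊆-refl)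
  ∷ All.map⁺ (All.map (λ ((t , w⊆ , len) , ⊆w) → (t , refl ∷ refl ∷ w⊆ , cong (λ n → suc (suc n)) len) , refl ∷ refl ∷ ⊆w)
                      (raised-sound j))

lowerCovers-sound : ∀ j → All (DyckSubwordFrom 0 j) (lowerCovers j)
lowerCovers-sound zero    = (_ , U ∷ʳ D ∷ʳ [] , refl) ∷ []
lowerCovers-sound (suc j) with raised-sound j
... | _ ∷ raised-j-sound = All.++⁺
  (All.map⁺ (All.map (λ (t , z⊆ , len) → t , refl ∷ refl ∷ z⊆ , cong (λ n → suc (suc n)) len) (lowerCovers-sound j)))
  (All.map⁺ (All.map (λ ((t , w⊆ , len) , _) → t , refl ∷ D ∷ʳ w⊆ , cong suc len) raised-j-sound))

lowerCovers-⊇-UD^ : ∀ j → All (UD^ j ⊆_) (lowerCovers (suc j))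
lowerCovers-⊇-UD^ zero    = (U ∷ʳ D ∷ʳ []) ∷ []
lowerCovers-⊇-UD^ (suc j) with raised-sound (suc j)
... | _ ∷ raised-sound-suc = All.++⁺
  (All.map⁺ (All.map (λ ⊆z → refl ∷ refl ∷ ⊆z) (lowerCovers-⊇-UD^ j)))
  (All.map⁺ (All.map (λ (_ , ⊆w) → U ∷ʳ ⊆w) raised-sound-suc))

raised-complete : ∀ j w → T (dyckFrom 1 w) → w ⊆ UD^ (suc j) → length w ≡ suc (length (UD^ j)) →
                  w ∈ (D ∷ UD^ j) ∷ raised j
raised-complete j w _ (U ∷ʳ w⊆) len = here (⊆∧length≡⇒≡ w⊆ len)
raised-complete j (U ∷ w) t (refl ∷ D ∷ʳ w⊆) len
  rewrite ⊆∧length≡⇒≡ w⊆ (ℕ.suc-injective len) = contradiction t (UD^-¬dyckFrom-suc 1 j)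
raised-complete zero    (U ∷ D ∷ []) _ (refl ∷ refl ∷ []) ()
raised-complete (suc j) (U ∷ D ∷ w) t (refl ∷ refl ∷ w⊆) len =
  there (∈-map⁺ _ (raised-complete j w t w⊆ (ℕ.suc-injective (ℕ.suc-injective len))))

lowerCovers-complete : ∀ j z → IsDyck z → z ⊆ UD^ (suc j) → length z ≡ length (UD^ j) → z ∈ lowerCovers j
lowerCovers-complete j z _ (U ∷ʳ D ∷ʳ z⊆) len rewrite ⊆∧length≡⇒≡ z⊆ len = UD^-∈-lowerCovers j
lowerCovers-complete j (D ∷ z) () (U ∷ʳ refl ∷ _) _
lowerCovers-complete zero    (U ∷ z) _ (refl ∷ D ∷ʳ _) ()
lowerCovers-complete (suc j) (U ∷ z) t (refl ∷ D ∷ʳ z⊆) len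
  with raised-complete j z t z⊆ (ℕ.suc-injective len)
... | here refl = UD^-∈-lowerCovers (suc j)
... | there z∈  = ∈-++⁺ʳ _ (∈-map⁺ (U ∷_) z∈)
lowerCovers-complete zero    (U ∷ D ∷ z) _ (refl ∷ refl ∷ _) ()
lowerCovers-complete (suc j) (U ∷ D ∷ z) t (refl ∷ refl ∷ z⊆) len =
  ∈-++⁺ˡ (∈-map⁺ _ (lowerCovers-complete j z t z⊆ (ℕ.suc-injective (ℕ.suc-injective len))))

U∷D∷-injective : _≡_ {A = Word} (U ∷ D ∷ xs) (U ∷ D ∷ ys) → xs ≡ ys
U∷D∷-injective refl = refl

D∷-∉-raised : ∀ j → ¬ (D ∷ w) ∈ raised j
D∷-∉-raised (suc j) D∷w∈ with ∈-map⁻ _ D∷w∈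
... | _ , _ , ()

raised-unique : ∀ j → Unique ((D ∷ UD^ j) ∷ raised j)
raised-unique zero    = [] ∷ []
raised-unique (suc j) = All.map⁺ (All.tabulate (λ _ ())) ∷ Unique.map⁺ U∷D∷-injective (raised-unique j)

lowerCovers-unique : ∀ j → Unique (lowerCovers j)
lowerCovers-unique zero    = [] ∷ []
lowerCovers-unique (suc j) with raised-unique j
... | _ ∷ raised-j-unique =
  Unique.++⁺ (Unique.map⁺ U∷D∷-injective (lowerCovers-unique j)) (Unique.map⁺ List.∷-injectiveʳ raised-j-unique) disjoint
  where
  disjoint : ∀ {v} → ¬ (v ∈ map (λ w → U ∷ D ∷ w) (lowerCovers j) × v ∈ map (U ∷_) (raised j))
  disjoint (v∈₁ , v∈₂) with ∈-map⁻ _ v∈₁ | ∈-map⁻ _ v∈₂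
  ... | _ , _ , refl | _ , D∷w∈ , refl = D∷-∉-raised j D∷w∈

length-raised : ∀ j → length (raised j) ≡ j
length-raised zero    = refl
length-raised (suc j) = cong suc (trans (List.length-map _ (raised j)) (length-raised j))

length-lowerCovers : ∀ j → length (lowerCovers j) ≡ suc (j C 2)
length-lowerCovers zero    = refl
length-lowerCovers (suc j) = begin
  length (map (λ w → U ∷ D ∷ w) (lowerCovers j) ++ map (U ∷_) (raised j))
    ≡⟨ List.length-++ (map (λ w → U ∷ D ∷ w) (lowerCovers j)) ⟩
  length (map (λ w → U ∷ D ∷ w) (lowerCovers j)) + length (map (U ∷_) (raised j))
    ≡⟨ cong₂ _+_ (trans (List.length-map _ (lowerCovers j)) (length-lowerCovers j))
                 (trans (List.length-map _ (raised j)) (length-raised j)) ⟩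
  suc (j C 2) + j
    ≡⟨ cong suc (ℕ.+-comm (j C 2) j) ⟩
  suc (j + j C 2)
    ≡⟨ cong (λ n → suc (n + j C 2)) (sym (nC1≡n j)) ⟩
  suc (j C 1 + j C 2)
    ≡⟨ cong suc (nCk+nC[k+1]≡[n+1]C[k+1] j 1) ⟩
  suc (suc j C 2) ∎
  where open ≡-Reasoning

bottom-∈-strictInterval : InPoset x → x ⊆ y → x ≢ y → x ∈ strictInterval x y
bottom-∈-strictInterval {x} {y} x∈P x⊆y x≢y = ∈-strictInterval⁺ x y (x⊆y , x∈P , ⊆-refl , x≢y)

module _ (m : ℕ) where

  private
    bottom top : Word
    bottom = UD^ (suc m)
    top    = UD^ (suc (suc (suc m)))

    bottom∈P : InPoset bottom
    bottom∈P = UD^-isDyck (suc m) , λ ()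

    cover-sound : z ∈ lowerCovers (suc (suc m)) → DyckSubwordFrom 0 (suc (suc m)) z
    cover-sound = All.lookup (lowerCovers-sound (suc (suc m)))

    bottom-⊆-cover : z ∈ lowerCovers (suc (suc m)) → bottom ⊆ z
    bottom-⊆-cover = All.lookup (lowerCovers-⊇-UD^ (suc m))

    length-cover : z ∈ lowerCovers (suc (suc m)) → length z ≡ 2 + length bottom
    length-cover z∈ = proj₂ (proj₂ (cover-sound z∈))

    cover≢top : z ∈ lowerCovers (suc (suc m)) → z ≢ top
    cover≢top z∈ refl = ℕ.m≢1+n+m (2 + length bottom) {1} (sym (length-cover z∈))

    cover≢[] : z ∈ lowerCovers (suc (suc m)) → z ≢ []
    cover≢[] z∈ refl = ℕ.0≢1+n (length-cover z∈)

  UD^-≢-lowerCover : z ∈ lowerCovers (suc (suc m)) → bottom ≢ z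
  UD^-≢-lowerCover z∈ refl = ℕ.m≢1+n+m (length bottom) {1} (length-cover z∈)

  UD^-≢-UD^-3+ : bottom ≢ top
  UD^-≢-UD^-3+ e = ℕ.m≢1+n+m (length bottom) {3} (cong length e)

  UD^-∷-lowerCovers-unique : Unique (bottom ∷ lowerCovers (suc (suc m)))
  UD^-∷-lowerCovers-unique = All.tabulate UD^-≢-lowerCover ∷ lowerCovers-unique (suc (suc m))

  UD^-strictInterval-rank2 : strictInterval bottom top ∼[ set ] bottom ∷ lowerCovers (suc (suc m))
  UD^-strictInterval-rank2 = mk⇔ to from
    where
    to : z ∈ strictInterval bottom top → z ∈ bottom ∷ lowerCovers (suc (suc m))
    to {z} z∈ with ∈-strictInterval⁻ bottom top z∈
    ... | z⊆top , (t , _) , bottom⊆z , z≢top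
      with even-gap (Even-length-UD^ (suc m)) (Even-dyckFrom 0 z t) (length-mono-≤ bottom⊆z) (length-mono-≤ z⊆top)
    ... | inj₁ e        = here (sym (⊆∧length≡⇒≡ bottom⊆z (sym e)))
    ... | inj₂ (inj₁ e) = there (lowerCovers-complete (suc (suc m)) z t z⊆top e)
    ... | inj₂ (inj₂ e) = contradiction (⊆∧length≡⇒≡ z⊆top e) z≢top

    from : z ∈ bottom ∷ lowerCovers (suc (suc m)) → z ∈ strictInterval bottom top
    from (here refl) = bottom-∈-strictInterval bottom∈P
      (⊆-trans (UD^-⊆-UD^-suc (suc m)) (UD^-⊆-UD^-suc (suc (suc m)))) UD^-≢-UD^-3+
    from (there z∈) with cover-sound z∈
    ... | t , z⊆top , _ =
      ∈-strictInterval⁺ bottom top (z⊆top , (t , cover≢[] z∈) , bottom-⊆-cover z∈ , cover≢top z∈)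

  UD^-strictInterval-cover : z ∈ lowerCovers (suc (suc m)) → strictInterval bottom z ∼[ set ] bottom ∷ []
  UD^-strictInterval-cover {z} z∈ = mk⇔ to from
    where
    to : w ∈ strictInterval bottom z → w ∈ bottom ∷ []
    to {w} w∈ with ∈-strictInterval⁻ bottom z w∈
    ... | w⊆z , (t , _) , bottom⊆w , w≢z
      with even-gap₂ (Even-length-UD^ (suc m)) (Even-dyckFrom 0 w t) (length-mono-≤ bottom⊆w)
                     (subst (length w ≤_) (length-cover z∈) (length-mono-≤ w⊆z))
    ... | inj₁ e = here (sym (⊆∧length≡⇒≡ bottom⊆w (sym e)))
    ... | inj₂ e = contradiction (⊆∧length≡⇒≡ w⊆z (trans e (sym (length-cover z∈)))) w≢z

    from : w ∈ bottom ∷ [] → w ∈ strictInterval bottom z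
    from (here refl) = bottom-∈-strictInterval bottom∈P (bottom-⊆-cover z∈) (UD^-≢-lowerCover z∈)

mainTheorem12 : (n : ℕ) → 2 ≤ n → μ (UD^ (n ∸ 1)) (UD^ (n + 1)) ≡ + (n C 2)
mainTheorem12 (suc (suc j)) _ rewrite ℕ.+-comm j 1 = begin
  μ (UD^ (suc j)) (UD^ (suc (suc (suc j))))
    ≡⟨ mobiusFuel-rank2 _ (UD^-≢-UD^-3+ j) (UD^-∷-lowerCovers-unique j)
         (UD^-strictInterval-rank2 j) (UD^-strictInterval-cover j) ⟩
  + length (lowerCovers (suc (suc j))) ℤ.- + 1
    ≡⟨ cong (λ c → + c ℤ.- + 1) (length-lowerCovers (suc (suc j))) ⟩
  + (suc (suc j) C 2) ∎
  where open ≡-Reasoning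
mainTheorem12 0             ()
mainTheorem12 1             (s≤s ())
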